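{- Let $\mathcal W$ be a category with terminal object $\top$, $\mathcal V$ a category, $U\in\mathcal V$, $-\ltimes U:\mathcal W\to\mathcal V$ a multiplier for $U$, and let $1$ denote the terminal presheaf on $\mathcal W$. Then the presheaf $T^1_U(\emptyset)$ on $\int_{\mathcal V}(1\ltimes\mathbf yU)$ (transpension of the empty presheaf) is isomorphic to the presheaf $B$ given by $B(V,\varphi)=\{\ast\}$ if $\pi_2\circ\varphi:V\to U$ is not dimensionally split, and $B(V,\varphi)=\emptyset$ otherwise.
   Context: A multiplier for $U$ is a functor $-\ltimes U:\mathcal W\to\mathcal V$ together with an isomorphism $\top\ltimes U\cong U$; $\pi_2:W\ltimes U\to U$ is $(!_W\ltimes U)$ followed by this isomorphism. A morphism $\varphi:V\to U$ is dimensionally split if there are $W\in\mathcal W$ and $\chi:W\ltimes U\to V$ with $\varphi\circ\chi=\pi_2$. For a presheaf $\Psi$ on $\mathcal W$, $\Psi\ltimes\mathbf yU$ is the presheaf on $\mathcal V$ with $(\Psi\ltimes\mathbf yU)(V)=\int^{W}\mathcal V(V,W\ltimes U)\times\Psi(W)$, whose elements are written $(\psi\ltimes\mathbf yU)\circ\chi$; $\pi_2:\Psi\ltimes\mathbf yU\to\mathbf yU$ sends $(\psi\ltimes\mathbf yU)\circ\chi$ to $\pi_2\circ\chi$, and for an element $\varphi$ we write $\pi_2\circ\varphi$ for its image, a morphism $V\to U$. $\int_{\mathcal C}\Gamma$ denotes the category of elements. The functor $\mathrm{Fr}^\Psi_U:\int_{\mathcal W}\Psi\to\int_{\mathcal V}(\Psi\ltimes\mathbf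 yU)$ sends $(W,\psi)$ to $(W\ltimes U,(\psi\ltimes\mathbf yU)\circ\mathrm{id})$ and $f$ to $f\ltimes U$. The transpension $T^\Psi_U$ is the right adjoint of precomposition with $\mathrm{Fr}^\Psi_U$: $(T^\Psi_U\Gamma)(V,\varphi)=\mathrm{Hom}\big((\mathrm{Fr}^\Psi_U)^*\mathbf y(V,\varphi),\Gamma\big)$, for $\Gamma$ a presheaf on $\int_{\mathcal W}\Psi$. -}

module Defs where

open import Level using (0ℓ)
open import Data.Product using (Σ; Σ-syntax; _×_; _,_; proj₁; proj₂)
open import Data.Unit using (tt) renaming (⊤ to Unit)
open import Data.Empty using (⊥)
open import Relation.Nullary using (¬_)
open import Relation.Binary using (Rel; IsEquivalence; Setoid)
import Relation.Binary.Reasoning.Setoid as SetoidR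

record Category : Set₁ where
  infixr 9 _∘_
  infix 4 _≈_
  field
    Obj : Set
    Hom : Obj → Obj → Set
    _≈_ : ∀ {A B} → Rel (Hom A B) 0ℓ
    ≈-equiv : ∀ {A B} → IsEquivalence (_≈_ {A} {B})
    id : ∀ {A} → Hom A A
    _∘_ : ∀ {A B C} → Hom B C → Hom A B → Hom A C
    ∘-resp-≈ : ∀ {A B C} {f h : Hom B C} {g i : Hom A B} →
               f ≈ h → g ≈ i → f ∘ g ≈ h ∘ i
    identityˡ : ∀ {A B} {f : Hom A B} → id ∘ f ≈ f
    identityʳ : ∀ {A B} {f : Hom A B} → f ∘ id ≈ f
    assoc : ∀ {A B C D} {f : Hom A B} {g : Hom B C} {h : Hom C D} →
            (h ∘ g) ∘ f ≈ h ∘ (g ∘ f)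

  module Equiv {A B : Obj} = IsEquivalence (≈-equiv {A} {B})

  hom-setoid : Obj → Obj → Setoid 0ℓ 0ℓ
  hom-setoid A B = record { Carrier = Hom A B ; _≈_ = _≈_ ; isEquivalence = ≈-equiv }

Ob : Category → Set
Ob = Category.Obj

Mor : (C : Category) → Ob C → Ob C → Set
Mor = Category.Hom

record Functor (C D : Category) : Set where
  private
    module C = Category C
    module D = Category D
  field
    F₀ : C.Obj → D.Obj
    F₁ : ∀ {A B} → C.Hom A B → D.Hom (F₀ A) (F₀ B)
    identity : ∀ {A} → F₁ (C.id {A}) D.≈ D.id
    homomorphism : ∀ {A B E} {f : C.Hom A B} {g : C.Hom B E} →
                   F₁ (g C.∘ f) D.≈ F₁ g D.∘ F₁ f
    F-resp-≈ : ∀ {A B} {f g : C.Hom A B} → f C.≈ g → F₁ f D.≈ F₁ g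

record Terminal (C : Category) : Set where
  open Category C
  field
    ⊤ₒ : Obj
    ! : ∀ {A} → Hom A ⊤ₒ
    !-unique : ∀ {A} (f : Hom A ⊤ₒ) → ! ≈ f

record Iso (C : Category) (A B : Ob C) : Set where
  open Category C
  field
    to : Hom A B
    from : Hom B A
    isoˡ : from ∘ to ≈ id
    isoʳ : to ∘ from ≈ id

record Presheaf (C : Category) : Set₁ where
  open Category C using (_∘_; id) renaming (_≈_ to _≈ₕ_)
  field
    F₀ : Ob C → Setoid 0ℓ 0ℓ
  Elt : Ob C → Set
  Elt A = Setoid.Carrier (F₀ A)
  _≈⟨_⟩_ : ∀ {A} → Elt A → (B : Ob C) → Elt A → Set
  _≈⟨_⟩_ {A} x _ y = Setoid._≈_ (F₀ A) x y
  field
    F₁ : ∀ {A B} → Mor C A B → Elt B → Elt A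
    F₁-cong : ∀ {A B} (f : Mor C A B) {x y : Elt B} →
              Setoid._≈_ (F₀ B) x y → Setoid._≈_ (F₀ A) (F₁ f x) (F₁ f y)
    F₁-resp : ∀ {A B} {f g : Mor C A B} (x : Elt B) →
              f ≈ₕ g → Setoid._≈_ (F₀ A) (F₁ f x) (F₁ g x)
    identity : ∀ {A} (x : Elt A) → Setoid._≈_ (F₀ A) (F₁ id x) x
    homomorphism : ∀ {A B E} {f : Mor C A B} {g : Mor C B E} (x : Elt E) →
                   Setoid._≈_ (F₀ A) (F₁ (g ∘ f) x) (F₁ f (F₁ g x))

module _ {C : Category} where

  record NatTrans (P Q : Presheaf C) : Set where
    private
      module P = Presheaf P
      module Q = Presheaf Q
    field
      η : ∀ A → P.Elt A → Q.Elt A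
      η-cong : ∀ A {x y : P.Elt A} →
               Setoid._≈_ (P.F₀ A) x y → Setoid._≈_ (Q.F₀ A) (η A x) (η A y)
      natural : ∀ {A B} (f : Mor C A B) (x : P.Elt B) →
                Setoid._≈_ (Q.F₀ A) (η A (P.F₁ f x)) (Q.F₁ f (η B x))

  NatTrans-setoid : Presheaf C → Presheaf C → Setoid 0ℓ 0ℓ
  NatTrans-setoid P Q = record
    { Carrier = NatTrans P Q
    ; _≈_ = λ α β → ∀ A (x : Presheaf.Elt P A) →
                    Setoid._≈_ (Presheaf.F₀ Q A) (NatTrans.η α A x) (NatTrans.η β A x)
    ; isEquivalence = record
      { refl = λ A x → Setoid.refl (Presheaf.F₀ Q A)
      ; sym = λ e A x → Setoid.sym (Presheaf.F₀ Q A) (e A x)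
      ; trans = λ e e' A x → Setoid.trans (Presheaf.F₀ Q A) (e A x) (e' A x)
      }
    }

  record NatIso (P Q : Presheaf C) : Set where
    field
      to : NatTrans P Q
      from : NatTrans Q P
      isoˡ : ∀ A (x : Presheaf.Elt P A) →
             Setoid._≈_ (Presheaf.F₀ P A) (NatTrans.η from A (NatTrans.η to A x)) x
      isoʳ : ∀ A (y : Presheaf.Elt Q A) →
             Setoid._≈_ (Presheaf.F₀ Q A) (NatTrans.η to A (NatTrans.η from A y)) y

codiscrete : Set → Setoid 0ℓ 0ℓ
codiscrete A = record
  { Carrier = A ; _≈_ = λ _ _ → Unit
  ; isEquivalence = record { refl = tt ; sym = λ _ → tt ; trans = λ _ _ → tt } }

1ₚ : (C : Category) → Presheaf C
1ₚ C = record
  { F₀ = λ _ → codiscrete Unit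
  ; F₁ = λ _ _ → tt
  ; F₁-cong = λ _ _ → tt ; F₁-resp = λ _ _ → tt
  ; identity = λ _ → tt ; homomorphism = λ _ → tt }

∅ₚ : (C : Category) → Presheaf C
∅ₚ C = record
  { F₀ = λ _ → codiscrete ⊥
  ; F₁ = λ _ x → x
  ; F₁-cong = λ _ _ → tt ; F₁-resp = λ _ _ → tt
  ; identity = λ _ → tt ; homomorphism = λ _ → tt }

y : (C : Category) → Ob C → Presheaf C
y C X = record
  { F₀ = λ A → hom-setoid A X
  ; F₁ = λ f g → g ∘ f
  ; F₁-cong = λ f e → ∘-resp-≈ e Equiv.refl
  ; F₁-resp = λ g e → ∘-resp-≈ Equiv.refl e
  ; identity = λ g → identityʳ
  ; homomorphism = λ g → Equiv.sym assoc }
  where open Category C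

y₁ : (C : Category) {A B : Ob C} → Mor C A B → NatTrans (y C A) (y C B)
y₁ C g = record
  { η = λ _ h → g ∘ h
  ; η-cong = λ _ e → ∘-resp-≈ Equiv.refl e
  ; natural = λ f h → Equiv.sym assoc }
  where open Category C

_∘ⁿ_ : {C : Category} {P Q R : Presheaf C} → NatTrans Q R → NatTrans P Q → NatTrans P R
_∘ⁿ_ {C} {P} {Q} {R} β α = record
  { η = λ A x → B.η A (A.η A x)
  ; η-cong = λ A e → B.η-cong A (A.η-cong A e)
  ; natural = λ {A} f x → Setoid.trans (Presheaf.F₀ R A)
                (B.η-cong A (A.natural f x)) (B.natural f (A.η _ x)) }
  where
    module A = NatTrans α
    module B = NatTrans β

_^* : {C D : Category} → Functor C D → Presheaf D → Presheaf C
_^* {C} {D} F P = record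
  { F₀ = λ A → P.F₀ (F.F₀ A)
  ; F₁ = λ f → P.F₁ (F.F₁ f)
  ; F₁-cong = λ f → P.F₁-cong (F.F₁ f)
  ; F₁-resp = λ x e → P.F₁-resp x (F.F-resp-≈ e)
  ; identity = λ {A} x → Setoid.trans (P.F₀ (F.F₀ A)) (P.F₁-resp x F.identity) (P.identity x)
  ; homomorphism = λ {A} x → Setoid.trans (P.F₀ (F.F₀ A)) (P.F₁-resp x F.homomorphism) (P.homomorphism x) }
  where
    module P = Presheaf P
    module F = Functor F

_^*₁ : {C D : Category} (F : Functor C D) {P Q : Presheaf D} → NatTrans P Q → NatTrans ((F ^*) P) ((F ^*) Q)
_^*₁ F α = record
  { η = λ A → α.η (Functor.F₀ F A)
  ; η-cong = λ A → α.η-cong (Functor.F₀ F A)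
  ; natural = λ f → α.natural (Functor.F₁ F f) }
  where module α = NatTrans α

∫ : (C : Category) → Presheaf C → Category
∫ C Γ = record
  { Obj = Σ (Ob C) Γ.Elt
  ; Hom = λ { (A , x) (B , y') → Σ (Mor C A B) λ f → Setoid._≈_ (Γ.F₀ A) (Γ.F₁ f y') x }
  ; _≈_ = λ f g → proj₁ f ≈ proj₁ g
  ; ≈-equiv = record { refl = Equiv.refl ; sym = Equiv.sym ; trans = Equiv.trans }
  ; id = λ { {A , x} → id , Γ.identity x }
  ; _∘_ = λ { {A , x} {B , y'} {E , z} (g , q) (f , p) →
              g ∘ f ,
              Setoid.trans (Γ.F₀ A) (Γ.homomorphism z)
                (Setoid.trans (Γ.F₀ A) (Γ.F₁-cong f q) p) }
  ; ∘-resp-≈ = ∘-resp-≈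
  ; identityˡ = identityˡ
  ; identityʳ = identityʳ
  ; assoc = assoc }
  where
    open Category C
    module Γ = Presheaf Γ

record Multiplier (𝒲 𝒱 : Category) (T : Terminal 𝒲) (U : Ob 𝒱) : Set where
  field
    ⋉U : Functor 𝒲 𝒱
    unit : Iso 𝒱 (Functor.F₀ ⋉U (Terminal.⊤ₒ T)) U

  open Category 𝒱
  open Functor ⋉U

  π₂ : (W : Ob 𝒲) → Mor 𝒱 (F₀ W) U
  π₂ W = Iso.to unit ∘ F₁ (Terminal.! T {W})

  DimSplit : {V : Ob 𝒱} → Mor 𝒱 V U → Set
  DimSplit {V} φ = Σ[ W ∈ Ob 𝒲 ] Σ[ χ ∈ Mor 𝒱 (F₀ W) V ] (φ ∘ χ ≈ π₂ W)

-- The presheaf  Ψ ⋉ y U  on 𝒱, defined as the coend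
--   (Ψ ⋉ y U)(V) = ∫^W 𝒱(V, W ⋉ U) × Ψ(W)
-- i.e. the quotient of  Σ W. 𝒱(V, W ⋉ U) × Ψ(W)  by the equivalence relation
-- generated by  ((f ⋉ U) ∘ χ , ψ) ~ (χ , Ψ(f) ψ)  (and the setoid equalities).

module CoendPresheaf {𝒲 𝒱 : Category} {T : Terminal 𝒲} {U : Ob 𝒱}
                     (M : Multiplier 𝒲 𝒱 T U) (Ψ : Presheaf 𝒲) where
  open Multiplier M
  open Functor ⋉U
  module 𝒱 = Category 𝒱
  module 𝒲 = Category 𝒲
  module Ψ = Presheaf Ψ

  -- representatives  (ψ ⋉ y U) ∘ χ
  Rep : Ob 𝒱 → Set
  Rep V = Σ[ W ∈ Ob 𝒲 ] (Mor 𝒱 V (F₀ W) × Ψ.Elt W)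

  data Gen {V : Ob 𝒱} : Rep V → Rep V → Set where
    step-eq : ∀ {W} {χ χ' : Mor 𝒱 V (F₀ W)} {ψ ψ' : Ψ.Elt W} →
              χ 𝒱.≈ χ' → Setoid._≈_ (Ψ.F₀ W) ψ ψ' → Gen (W , χ , ψ) (W , χ' , ψ')
    step-coend : ∀ {W W'} (f : Mor 𝒲 W W') (χ : Mor 𝒱 V (F₀ W)) (ψ : Ψ.Elt W') →
                 Gen (W' , F₁ f 𝒱.∘ χ , ψ) (W , χ , Ψ.F₁ f ψ)

  data _∼_ {V : Ob 𝒱} : Rep V → Rep V → Set where
    gen : ∀ {x y'} → Gen x y' → x ∼ y'
    ∼-refl : ∀ {x} → x ∼ x
    ∼-sym : ∀ {x y'} → x ∼ y' → y' ∼ x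
    ∼-trans : ∀ {x y' z} → x ∼ y' → y' ∼ z → x ∼ z

  Rep-setoid : Ob 𝒱 → Setoid 0ℓ 0ℓ
  Rep-setoid V = record
    { Carrier = Rep V ; _≈_ = _∼_
    ; isEquivalence = record { refl = ∼-refl ; sym = ∼-sym ; trans = ∼-trans } }

  act : ∀ {V' V} → Mor 𝒱 V' V → Rep V → Rep V'
  act g (W , χ , ψ) = W , χ 𝒱.∘ g , ψ

  act-gen : ∀ {V' V} (g : Mor 𝒱 V' V) {x x' : Rep V} → Gen x x' → act g x ∼ act g x'
  act-gen g (step-eq e e') = gen (step-eq (𝒱.∘-resp-≈ e 𝒱.Equiv.refl) e')
  act-gen g (step-coend f χ ψ) =
    ∼-trans (gen (step-eq 𝒱.assoc (Setoid.refl (Ψ.F₀ _)))) (gen (step-coend f (χ 𝒱.∘ g) ψ))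

  act-cong : ∀ {V' V} (g : Mor 𝒱 V' V) {x x' : Rep V} → x ∼ x' → act g x ∼ act g x'
  act-cong g (gen r) = act-gen g r
  act-cong g ∼-refl = ∼-refl
  act-cong g (∼-sym e) = ∼-sym (act-cong g e)
  act-cong g (∼-trans e e') = ∼-trans (act-cong g e) (act-cong g e')

  ⋉y : Presheaf 𝒱
  ⋉y = record
    { F₀ = Rep-setoid
    ; F₁ = act
    ; F₁-cong = act-cong
    ; F₁-resp = λ x e → gen (step-eq (𝒱.∘-resp-≈ 𝒱.Equiv.refl e) (Setoid.refl (Ψ.F₀ _)))
    ; identity = λ x → gen (step-eq 𝒱.identityʳ (Setoid.refl (Ψ.F₀ _)))
    ; homomorphism = λ x → gen (step-eq (𝒱.Equiv.sym 𝒱.assoc) (Setoid.refl (Ψ.F₀ _))) }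

  -- π₂ : Ψ ⋉ y U → y U on representatives:  (ψ ⋉ y U) ∘ χ  ↦  π₂ ∘ χ
  π₂∘ : ∀ {V} → Rep V → Mor 𝒱 V U
  π₂∘ (W , χ , ψ) = π₂ W 𝒱.∘ χ

  private
    π₂-gen : ∀ {V} {x x' : Rep V} → Gen x x' → π₂∘ x 𝒱.≈ π₂∘ x'
    π₂-gen (step-eq e _) = 𝒱.∘-resp-≈ 𝒱.Equiv.refl e
    π₂-gen (step-coend {W} {W'} f χ ψ) = begin
        (to ∘ F₁ (! {W'})) ∘ (F₁ f ∘ χ) ≈⟨ 𝒱.assoc ⟩
        to ∘ (F₁ (! {W'}) ∘ (F₁ f ∘ χ)) ≈⟨ ∘-resp-≈ Equiv.refl (Equiv.sym 𝒱.assoc) ⟩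
        to ∘ ((F₁ (! {W'}) ∘ F₁ f) ∘ χ) ≈⟨ ∘-resp-≈ Equiv.refl (∘-resp-≈ (Equiv.sym homomorphism) Equiv.refl) ⟩
        to ∘ (F₁ (! {W'} 𝒲.∘ f) ∘ χ)    ≈⟨ ∘-resp-≈ Equiv.refl (∘-resp-≈ (F-resp-≈ (𝒲.Equiv.sym (!-unique _))) Equiv.refl) ⟩
        to ∘ (F₁ (! {W}) ∘ χ)            ≈⟨ Equiv.sym 𝒱.assoc ⟩
        (to ∘ F₁ (! {W})) ∘ χ            ∎
      where
        open Category 𝒱
        open Iso unit
        open Terminal T
        open SetoidR (hom-setoid _ U)

  π₂-cong : ∀ {V} {x x' : Rep V} → x ∼ x' → π₂∘ x 𝒱.≈ π₂∘ x'
  π₂-cong (gen r) = π₂-gen r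
  π₂-cong ∼-refl = 𝒱.Equiv.refl
  π₂-cong (∼-sym e) = 𝒱.Equiv.sym (π₂-cong e)
  π₂-cong (∼-trans e e') = 𝒱.Equiv.trans (π₂-cong e) (π₂-cong e')

  Fr : Functor (∫ 𝒲 Ψ) (∫ 𝒱 ⋉y)
  Fr = record
    { F₀ = λ { (W , ψ) → F₀ W , (W , 𝒱.id , ψ) }
    ; F₁ = λ { {W' , ψ'} {W , ψ} (f , p) →
               F₁ f ,
               ∼-trans (gen (step-eq (𝒱.Equiv.trans 𝒱.identityˡ (𝒱.Equiv.sym 𝒱.identityʳ))
                                     (Setoid.refl (Ψ.F₀ W))))
                 (∼-trans (gen (step-coend f 𝒱.id ψ))
                          (gen (step-eq 𝒱.Equiv.refl p))) }
    ; identity = identity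
    ; homomorphism = homomorphism
    ; F-resp-≈ = F-resp-≈ }

  Transpension : Presheaf (∫ 𝒲 Ψ) → Presheaf (∫ 𝒱 ⋉y)
  Transpension Γ = record
    { F₀ = λ Vφ → NatTrans-setoid ((Fr ^*) (y (∫ 𝒱 ⋉y) Vφ)) Γ
    ; F₁ = λ g α → α ∘ⁿ (Fr ^*₁) (y₁ (∫ 𝒱 ⋉y) g)
    ; F₁-cong = λ g e A x → e A _
    ; F₁-resp = λ {_} {_} {f} {g} α e A x →
        NatTrans.η-cong α A (∫V.∘-resp-≈ {f = f} {h = g} {g = x} {i = x} e (∫V.Equiv.refl {x = x}))
    ; identity = λ α A x → NatTrans.η-cong α A (∫V.identityˡ {f = x})
    ; homomorphism = λ {_} {_} {_} {f} {g} α A x →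
        NatTrans.η-cong α A (∫V.assoc {f = x} {g = f} {h = g}) }
    where module ∫V = Category (∫ 𝒱 ⋉y)

  -- The presheaf B on ∫_𝒱 (Ψ ⋉ y U):
  --   B(V, φ) = {*} if π₂ ∘ φ is not dimensionally split, ∅ otherwise.
  -- (Realised as the proposition  ¬ DimSplit (π₂ ∘ φ)  with all elements equal.)

  B : Presheaf (∫ 𝒱 ⋉y)
  B = record
    { F₀ = λ { (V , φ) → codiscrete (¬ DimSplit (π₂∘ φ)) }
    ; F₁ = λ { {V' , φ'} {V , φ} (g , p) nφ (W₀ , χ₀ , e) →
               nφ (W₀ , g 𝒱.∘ χ₀ ,
                   𝒱.Equiv.trans (𝒱.Equiv.sym 𝒱.assoc)
                     (𝒱.Equiv.trans
                       (𝒱.∘-resp-≈ (𝒱.Equiv.trans 𝒱.assoc (π₂-cong p)) 𝒱.Equiv.refl)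
                       e)) }
    ; F₁-cong = λ _ _ → tt ; F₁-resp = λ _ _ → tt
    ; identity = λ _ → tt ; homomorphism = λ _ → tt }

{-# OPTIONS --safe #-}
module Submission where

-- For the terminal presheaf the coend collapses: every representative (W , χ) is identified
-- with (⊤ , !⋉U ∘ χ), so 1 ⋉ y U ≅ y U via π₂. An element of Fr^* y(V, φ) at W is then a
-- morphism χ : W ⋉ U → V with π₂ ∘ φ ∘ χ = π₂, i.e. a dimensional splitting of π₂ ∘ φ through W.
-- A natural transformation into the empty presheaf exists exactly when its domain has no
-- elements, so T(∅)(V, φ) is inhabited exactly when π₂ ∘ φ is not dimensionally split.

open import Defs
open import Data.Product using (Σ; _,_)
open import Data.Unit using (tt)
open import Function using (_∘′_)
open import Relation.Nullary using (¬_)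
import Relation.Binary.Reasoning.Setoid as SetoidR

module _ {C : Category} where
  open Category C

  iso-to-monic : ∀ {A B X} (i : Iso C A B) {f g : Hom X A} →
                 Iso.to i ∘ f ≈ Iso.to i ∘ g → f ≈ g
  iso-to-monic {A} {X = X} i {f} {g} e = begin
      f                 ≈⟨ Equiv.sym identityˡ ⟩
      id ∘ f            ≈⟨ ∘-resp-≈ (Equiv.sym isoˡ) Equiv.refl ⟩
      (from ∘ to) ∘ f   ≈⟨ assoc ⟩
      from ∘ (to ∘ f)   ≈⟨ ∘-resp-≈ Equiv.refl e ⟩
      from ∘ (to ∘ g)   ≈⟨ Equiv.sym assoc ⟩
      (from ∘ to) ∘ g   ≈⟨ ∘-resp-≈ isoˡ Equiv.refl ⟩
      id ∘ g            ≈⟨ identityˡ ⟩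
      g                 ∎
    where
      open Iso i
      open SetoidR (hom-setoid X A)

module _ {C : Category} (P : Presheaf C) where
  open Presheaf P using (Elt)

  hom-to-∅⇒empty : NatTrans P (∅ₚ C) → ¬ Σ (Ob C) Elt
  hom-to-∅⇒empty α (A , x) = NatTrans.η α A x

  empty⇒hom-to-∅ : ¬ Σ (Ob C) Elt → NatTrans P (∅ₚ C)
  empty⇒hom-to-∅ ¬x = record
    { η = λ A x → ¬x (A , x)
    ; η-cong = λ _ _ → tt
    ; natural = λ _ _ → tt }

module TerminalCoend {𝒲 𝒱 : Category} {T : Terminal 𝒲} {U : Ob 𝒱}
                     (M : Multiplier 𝒲 𝒱 T U) where
  open CoendPresheaf M (1ₚ 𝒲)
  open Multiplier M using (DimSplit; π₂; unit)
  open Functor (Multiplier.⋉U M)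
  open Terminal T
  open Category 𝒱

  ∼-⊤-representative : ∀ {V} W (χ : Hom V (F₀ W)) → (W , χ , tt) ∼ (⊤ₒ , F₁ ! ∘ χ , tt)
  ∼-⊤-representative W χ = ∼-sym (gen (step-coend ! χ tt))

  π₂∘-injective : ∀ {V} (x x' : Rep V) → π₂∘ x ≈ π₂∘ x' → x ∼ x'
  π₂∘-injective (W , χ , tt) (W' , χ' , tt) e =
    ∼-trans (∼-⊤-representative W χ)
      (∼-trans (gen (step-eq (iso-to-monic unit e') tt))
               (∼-sym (∼-⊤-representative W' χ')))
    where
      e' : Iso.to unit ∘ (F₁ ! ∘ χ) ≈ Iso.to unit ∘ (F₁ ! ∘ χ')
      e' = Equiv.trans (Equiv.sym assoc) (Equiv.trans e assoc)

  FrElements : Ob (∫ 𝒱 ⋉y) → Set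
  FrElements Vφ = Σ (Ob (∫ 𝒲 (1ₚ 𝒲))) (Presheaf.Elt ((Fr ^*) (y (∫ 𝒱 ⋉y) Vφ)))

  dimSplit⇒FrElement : ∀ {V} (φ : Rep V) → DimSplit (π₂∘ φ) → FrElements (V , φ)
  dimSplit⇒FrElement φ (W , χ , e) =
    (W , tt) , χ , π₂∘-injective _ _
      (Equiv.trans (Equiv.sym assoc) (Equiv.trans e (Equiv.sym identityʳ)))

  FrElement⇒dimSplit : ∀ {V} (φ : Rep V) → FrElements (V , φ) → DimSplit (π₂∘ φ)
  FrElement⇒dimSplit φ ((W , tt) , χ , p) =
    W , χ , Equiv.trans assoc (Equiv.trans (π₂-cong p) identityʳ)

-- Both presheaves have codiscrete fibres (maps into ∅ are pointwise equal for free),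
-- so all coherence conditions hold trivially and only the two fibrewise maps carry content.
mainTheorem2 : (𝒲 𝒱 : Category) (T : Terminal 𝒲) (U : Category.Obj 𝒱)
    (M : Multiplier 𝒲 𝒱 T U) →
    NatIso (CoendPresheaf.Transpension M (1ₚ 𝒲) (∅ₚ (∫ 𝒲 (1ₚ 𝒲))))
           (CoendPresheaf.B M (1ₚ 𝒲))
mainTheorem2 𝒲 𝒱 T U M = record
  { to = record
    { η = λ { (V , φ) α → hom-to-∅⇒empty _ α ∘′ dimSplit⇒FrElement φ }
    ; η-cong = λ _ _ → tt
    ; natural = λ _ _ → tt }
  ; from = record
    { η = λ { (V , φ) ¬split → empty⇒hom-to-∅ _ (¬split ∘′ FrElement⇒dimSplit φ) }
    ; η-cong = λ _ _ _ _ → tt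
    ; natural = λ _ _ _ _ → tt }
  ; isoˡ = λ _ _ _ _ → tt
  ; isoʳ = λ _ _ → tt }
  where open TerminalCoend M
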